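{- Let $\rho$ be an $a\times b$ partial permutation matrix with minimal length embedding $\tilde\rho\in S_{a+b}$, and let $u_1u_2\cdots u_{\ell(\tilde\rho)}$ be the canonical reduced word for $\tilde\rho$. Then the set $\{k_1<k_2<\cdots<k_p\}$ of indices $k$ with $u_k<u_{k+1}$ has size $p\le a$. Moreover, for each $1\le j\le p$ one has $j\le u_k$ for all $k\in[k_{j-1}+1,k_j]$, where $k_0=0$.
   Context: For an $a\times b$ partial permutation matrix $\rho$ (a $(0,1)$-matrix with at most one $1$ in each row and column), its minimal length embedding $\tilde\rho\in S_{a+b}$ is the $(a+b)\times(a+b)$ permutation matrix with $\rho$ as northwest $a\times b$ submatrix, where in columns $b+1,\dots,a+b$ one places $1$'s in those of the top $a$ rows lacking a $1$ in $\rho$ (proceeding northwest to southeast), and in rows $a+1,\dots,a+b$ one places $1$'s in those columns lacking a $1$ (proceeding northwest to southeast); $\tilde\rho(i)=j$ iff the $(i,j)$ entry is $1$. The diagram $D(\tilde\rho)$ is the set of boxes $(i,j)$ of the $(a+b)\times(a+b)$ grid with $\tilde\rho(i)>j$ and $\tilde\rho^{ -1}(j)>i$. The canonical reduced word of $\tilde\rho$ is obtained by labeling the boxes of each row $i$ of $D(\tilde\rho)$ consecutively from right to left by $i,i+1,i+2,\dots$, and then reading the labels of each row from left to right, rows taken from top to bottom. -}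

module Defs where

open import Data.Nat using (ℕ; zero; suc; _+_; _∸_; _<ᵇ_; _≡ᵇ_; _<?_)
open import Data.Bool using (Bool; true; false; not; _∧_; if_then_else_)
open import Data.Fin using (Fin; fromℕ<)
open import Data.Maybe using (Maybe; just; nothing)
open import Data.List using (List; []; _∷_; _++_; map; length; upTo; concatMap; filterᵇ; reverse)
open import Data.Bool.ListAction using (any)
open import Data.Product using (_×_)
open import Relation.Nullary using (yes; no)
open import Relation.Binary.PropositionalEquality using (_≡_)

Matrix : ℕ → ℕ → Set
Matrix a b = Fin a → Fin b → Bool

IsPartialPerm : ∀ {a b} → Matrix a b → Set
IsPartialPerm M =
  (∀ i j j′ → M i j ≡ true → M i j′ ≡ true → j ≡ j′) ×
  (∀ i i′ j → M i j ≡ true → M i′ j ≡ true → i ≡ i′)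

range1 : ℕ → List ℕ
range1 n = map suc (upTo n)

nth : List ℕ → ℕ → ℕ
nth []       _       = 0
nth (x ∷ xs) zero    = x
nth (x ∷ xs) (suc k) = nth xs k

-- 1-indexed position of x in a list (0 if absent)
posOf : ℕ → List ℕ → ℕ
posOf x []       = 0
posOf x (y ∷ ys) = if x ≡ᵇ y then 1 else (if posOf x ys ≡ᵇ 0 then 0 else suc (posOf x ys))

-- 1-indexed entry of the matrix (false outside the a×b range)
ent : ∀ {a b} → Matrix a b → ℕ → ℕ → Bool
ent {a} {b} M zero    _       = false
ent {a} {b} M (suc i) zero    = false
ent {a} {b} M (suc i) (suc j) with i <? a | j <? b
... | yes p | yes q = M (fromℕ< p) (fromℕ< q)
... | _     | _     = false

rowOne : ∀ {a b} → Matrix a b → ℕ → Maybe ℕ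
rowOne {a} {b} M i = first (range1 b)
  where
  first : List ℕ → Maybe ℕ
  first []       = nothing
  first (j ∷ js) = if ent M i j then just j else first js

isNothing′ : Maybe ℕ → Bool
isNothing′ nothing  = true
isNothing′ (just _) = false

lackRows : ∀ {a b} → Matrix a b → List ℕ
lackRows {a} M = filterᵇ (λ i → isNothing′ (rowOne M i)) (range1 a)

-- value of the minimal length embedding on a top row i ∈ [1..a]
embTop : ∀ {a b} → Matrix a b → ℕ → ℕ
embTop {a} {b} M i with rowOne M i
... | just j  = j
... | nothing = b + posOf i (lackRows M)

lackCols : ∀ {a b} → Matrix a b → List ℕ
lackCols {a} {b} M =
  filterᵇ (λ j → not (any (λ i → embTop M i ≡ᵇ j) (range1 a))) (range1 (a + b))

-- one-line notation [ρ̃(1), …, ρ̃(a+b)] of the minimal length embedding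
embedding : ∀ {a b} → Matrix a b → List ℕ
embedding {a} M = map (embTop M) (range1 a) ++ lackCols M

perm : List ℕ → ℕ → ℕ
perm w i = nth w (i ∸ 1)

permInv : List ℕ → ℕ → ℕ
permInv w j = posOf j w

inDiagram : List ℕ → ℕ → ℕ → Bool
inDiagram w i j = (j <ᵇ perm w i) ∧ (i <ᵇ permInv w j)

rowBoxes : List ℕ → ℕ → List ℕ
rowBoxes w i = filterᵇ (inDiagram w i) (range1 (length w))

-- row i labelled right-to-left by i, i+1, …, read left to right
rowWord : List ℕ → ℕ → List ℕ
rowWord w i = map (λ t → i + t) (reverse (upTo (length (rowBoxes w i))))

canonicalWordOf : List ℕ → List ℕ
canonicalWordOf w = concatMap (rowWord w) (range1 (length w))

canonicalWord : ∀ {a b} → Matrix a b → List ℕ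
canonicalWord M = canonicalWordOf (embedding M)

letter : List ℕ → ℕ → ℕ
letter u k = nth u (k ∸ 1)

ascents : List ℕ → List ℕ
ascents u = filterᵇ (λ k → letter u k <ᵇ letter u (suc k)) (range1 (length u ∸ 1))

{-# OPTIONS --safe #-}
-- Row i of the diagram of a permutation contributes the decreasing run
-- i+c−1, …, i+1, i to the canonical word, c being the number of boxes in the
-- row.  Each run begins above the last letter i of the previous nonempty run,
-- so the ascents are exactly the junctions between consecutive nonempty runs:
-- a letter preceded by j−1 ascents lies in the j-th nonempty row or a later
-- one, hence is at least j.  The minimal length embedding lists the missing
-- columns in increasing order in its bottom rows, which therefore carry no
-- boxes; so only the top a rows are nonempty and there are at most a
-- ascents.
module Submission where

open import Defs
open import Data.Nat using (ℕ; zero; suc; _+_; _∸_; _≤_; _<_; _<ᵇ_; _≡ᵇ_; z≤n; s≤s; s≤s⁻¹; _<?_)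
open import Data.Nat.Properties
  using ( module ≤-Reasoning; ≤-trans; <-trans; <⇒≤; <-asym; ≤⇒≯; ≮⇒≥; n≤1+n; m≤m+n; m≤n+m; m∸n≤m
        ; +-identityʳ; +-suc; +-monoʳ-≤; <ᵇ⇒<; <⇒<ᵇ; ≡ᵇ⇒≡)
open import Data.Bool using (Bool; true; false; T)
open import Data.Bool.Properties using (T-∧)
open import Data.Unit using (tt)
open import Data.List using (List; []; _∷_; _++_; map; length; upTo; downFrom; concatMap; filterᵇ)
open import Data.List.Properties
  using (map-upTo; reverse-upTo; length-map; length-upTo; concatMap-cong; filter-none; filter-accept; filter-reject)
open import Data.List.Relation.Unary.All as All using (All; []; _∷_)
import Data.List.Relation.Unary.All.Properties as All
open import Data.List.Relation.Unary.AllPairs using (AllPairs; []; _∷_)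
import Data.List.Relation.Unary.AllPairs.Properties as AllPairs
open import Data.Product using (_×_; _,_; proj₁; proj₂; ∃-syntax)
open import Function using (_∘_; Equivalence)
open import Relation.Nullary using (¬_; yes; no; contradiction)
open import Relation.Nullary.Decidable using (T?)
open import Relation.Binary.PropositionalEquality using (_≡_; refl; sym; trans; cong; subst; module ≡-Reasoning)

private
  variable
    c x y i j k p q s s′ t : ℕ
    xs ys r v : List ℕ

nth-All : ∀ {P : ℕ → Set} → All P xs → i < length xs → P (nth xs i)
nth-All {i = zero}  (px ∷ _)  _         = px
nth-All {i = suc i} (_ ∷ pxs) (s≤s i<n) = nth-All pxs i<n

nth-strictMono : AllPairs _<_ xs → p < q → q < length xs → nth xs p < nth xs q
nth-strictMono {p = zero}  {suc q} (x<xs ∷ _)  _         (s≤s q<n) = nth-All x<xs q<n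
nth-strictMono {p = suc p} {suc q} (_ ∷ sorted) (s≤s p<q) (s≤s q<n) = nth-strictMono sorted p<q q<n

nth-++-strictMonoʳ : AllPairs _<_ ys → length xs ≤ p → p < q → q < length (xs ++ ys) →
  nth (xs ++ ys) p < nth (xs ++ ys) q
nth-++-strictMonoʳ {xs = []}     sorted _ = nth-strictMono sorted
nth-++-strictMonoʳ {xs = _ ∷ xs} {suc p} {suc q} sorted (s≤s n≤p) (s≤s p<q) (s≤s q<n) =
  nth-++-strictMonoʳ {xs = xs} sorted n≤p p<q q<n

range1-suc : ∀ n → range1 (suc n) ≡ 1 ∷ map suc (range1 n)
range1-suc n = cong (λ l → 1 ∷ map suc l) (sym (map-upTo suc n))

range1-bounds : ∀ n → All (λ k → 1 ≤ k × k ≤ n) (range1 n)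
range1-bounds n =
  subst (All _) (sym (map-upTo suc n)) (All.applyUpTo⁺₁ suc n (λ i<n → s≤s z≤n , i<n))

range1-sorted : ∀ n → AllPairs _<_ (range1 n)
range1-sorted n =
  subst (AllPairs _<_) (sym (map-upTo suc n)) (AllPairs.applyUpTo⁺₁ suc n (λ i<j _ → s≤s i<j))

filterᵇ-map : ∀ {A B : Set} (p : B → Bool) (f : A → B) as →
  filterᵇ p (map f as) ≡ map f (filterᵇ (p ∘ f) as)
filterᵇ-map p f []       = refl
filterᵇ-map p f (a ∷ as) with p (f a)
... | true  = cong (f a ∷_) (filterᵇ-map p f as)
... | false = filterᵇ-map p f as

countBelow : ℕ → List ℕ → ℕ
countBelow k xs = length (filterᵇ (_<ᵇ k) xs)

countBelow-map-suc : ∀ k xs → countBelow (suc k) (map suc xs) ≡ countBelow k xs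
countBelow-map-suc k xs =
  trans (cong length (filterᵇ-map (_<ᵇ suc k) suc xs)) (length-map suc (filterᵇ (_<ᵇ k) xs))

countBelow-1 : All (1 ≤_) xs → countBelow 1 xs ≡ 0
countBelow-1 positive =
  cong length (filter-none (T? ∘ (_<ᵇ 1)) (All.map (λ { (s≤s z≤n) () }) positive))

countBelow-∷ : x < k → countBelow k (x ∷ xs) ≡ suc (countBelow k xs)
countBelow-∷ {x} {k} {xs} x<k =
  cong length (filter-accept (T? ∘ (_<ᵇ k)) {x = x} {xs = xs} (<⇒<ᵇ x<k))

countBelow-nth : AllPairs _<_ xs → i < length xs → nth xs i < k → suc i ≤ countBelow k xs
countBelow-nth {_ ∷ _} {zero}  _               _         x<k  =
  subst (1 ≤_) (sym (countBelow-∷ x<k)) (s≤s z≤n)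
countBelow-nth {_ ∷ _} {suc i} (x<xs ∷ sorted) (s≤s i<n) xᵢ<k =
  subst (suc (suc i) ≤_) (sym (countBelow-∷ (<-trans (nth-All x<xs i<n) xᵢ<k)))
    (s≤s (countBelow-nth sorted i<n xᵢ<k))

countBelow-nth-0∷ : AllPairs _<_ xs → i ≤ length xs → nth (0 ∷ xs) i < k → i ≤ countBelow k xs
countBelow-nth-0∷ {i = zero}  _      _   _     = z≤n
countBelow-nth-0∷ {i = suc i} sorted i<n xᵢ<k = countBelow-nth sorted i<n xᵢ<k

posOf-sound : ∀ x ys → posOf x ys ≡ suc q → nth ys q ≡ x × q < length ys
posOf-sound x (y ∷ ys) _ with x ≡ᵇ y in x≡ᵇy
posOf-sound x (y ∷ ys) refl | true = sym (≡ᵇ⇒≡ x y (subst T (sym x≡ᵇy) tt)) , s≤s z≤n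
... | false with posOf x ys in pos
posOf-sound x (y ∷ ys) refl | false | suc q =
  let wq≡x , q<n = posOf-sound x ys pos in wq≡x , s≤s q<n

inDiagram⇒inversion : ∀ w i j → T (inDiagram w (suc i) j) →
  ∃[ q ] i < q × q < length w × nth w q < nth w i
inDiagram⇒inversion w i j box = fromPosition (posOf j w) refl w⁻¹j>i
  where
  j<wi : T (j <ᵇ nth w i)
  j<wi = proj₁ (Equivalence.to T-∧ box)
  w⁻¹j>i : T (suc i <ᵇ posOf j w)
  w⁻¹j>i = proj₂ (Equivalence.to T-∧ box)
  fromPosition : ∀ p → posOf j w ≡ p → T (suc i <ᵇ p) →
    ∃[ q ] i < q × q < length w × nth w q < nth w i
  fromPosition (suc q) pos i<q =
    let wq≡j , q<n = posOf-sound j w pos in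
    q , s≤s⁻¹ (<ᵇ⇒< _ _ i<q) , q<n , subst (_< nth w i) (sym wq≡j) (<ᵇ⇒< _ _ j<wi)

rowBoxes-++-beyond : AllPairs _<_ ys → length xs < i → rowBoxes (xs ++ ys) i ≡ []
rowBoxes-++-beyond {ys} {xs} {suc i} sorted (s≤s n≤i) =
  filter-none (T? ∘ inDiagram w (suc i)) (All.universal noBox (range1 (length w)))
  where
  w : List ℕ
  w = xs ++ ys
  noBox : ∀ j → ¬ T (inDiagram w (suc i) j)
  noBox j box =
    let q , i<q , q<n , wq<wi = inDiagram⇒inversion w i j box in
    <-asym (nth-++-strictMonoʳ {xs = xs} sorted n≤i i<q q<n) wq<wi

descendingRun : ℕ → ℕ → List ℕ
descendingRun i c = map (i +_) (downFrom c)

descendingRun-lowerBound : i ≤ j → ∀ c → All (i ≤_) (descendingRun j c)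
descendingRun-lowerBound {j = j} i≤j c =
  All.map⁺ (All.universal (λ d → ≤-trans i≤j (m≤m+n j d)) (downFrom c))

rowWord≡descendingRun : ∀ w i → rowWord w i ≡ descendingRun i (length (rowBoxes w i))
rowWord≡descendingRun w i = cong (map (i +_)) (reverse-upTo _)

-- Staircase t s u: a floor starting at height s and rising by one at each
-- ascent of u stays weakly below every letter and ends at height at most t.
data Staircase (t : ℕ) : ℕ → List ℕ → Set where
  empty   : Staircase t s []
  final   : s ≤ x → s ≤ t → Staircase t s (x ∷ [])
  ascent  : s ≤ x → x < y → Staircase t (suc s) (y ∷ r) → Staircase t s (x ∷ y ∷ r)
  descent : s ≤ x → y ≤ x → Staircase t s (y ∷ r) → Staircase t s (x ∷ y ∷ r)

staircase-lowerFloor : s ≤ s′ → Staircase t s′ v → Staircase t s v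
staircase-lowerFloor s≤s′ empty                 = empty
staircase-lowerFloor s≤s′ (final s′≤x s′≤t)     = final (≤-trans s≤s′ s′≤x) (≤-trans s≤s′ s′≤t)
staircase-lowerFloor s≤s′ (ascent s′≤x x<y st)  =
  ascent (≤-trans s≤s′ s′≤x) x<y (staircase-lowerFloor (s≤s s≤s′) st)
staircase-lowerFloor s≤s′ (descent s′≤x y≤x st) =
  descent (≤-trans s≤s′ s′≤x) y≤x (staircase-lowerFloor s≤s′ st)

staircase-++-run : s ≤ i → i ≤ t → All (i <_) v → Staircase t (suc s) v →
  ∀ c → Staircase t s (descendingRun i (suc c) ++ v)
staircase-++-run {i = i} {v = []}    s≤i i≤t _         _  zero =
  final (≤-trans s≤i (m≤m+n i 0)) (≤-trans s≤i i≤t)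
staircase-++-run {i = i} {v = _ ∷ _} s≤i i≤t (i<y ∷ _) st zero =
  ascent (≤-trans s≤i (m≤m+n i 0)) (subst (_< _) (sym (+-identityʳ i)) i<y) st
staircase-++-run {i = i} s≤i i≤t i<v st (suc c) =
  descent (≤-trans s≤i (m≤m+n i (suc c))) (+-monoʳ-≤ i (n≤1+n c))
    (staircase-++-run s≤i i≤t i<v st c)

staircase-++-row : (t < i → c ≡ 0) → s ≤ i → All (i <_) v → Staircase t (suc s) v →
  Staircase t s (descendingRun i c ++ v)
staircase-++-row {c = zero}  _      _   _   st = staircase-lowerFloor (n≤1+n _) st
staircase-++-row {t} {i} {suc c} vanish s≤i i<v st with t <? i
... | yes t<i = contradiction (vanish t<i) λ ()
... | no  t≮i = staircase-++-run s≤i (≮⇒≥ t≮i) i<v st c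

staircase-rows : ∀ (c : ℕ → ℕ) {L} →
  (∀ {i} → t < i → c i ≡ 0) → AllPairs _<_ L → All (s ≤_) L →
  Staircase t s (concatMap (λ i → descendingRun i (c i)) L)
staircase-rows c vanish []             []           = empty
staircase-rows c vanish (i<L ∷ sorted) (s≤i ∷ _) =
  staircase-++-row vanish s≤i
    (All.concat⁺ (All.map⁺ (All.map (λ i<j → descendingRun-lowerBound i<j _) i<L)))
    (staircase-rows c vanish sorted (All.map (≤-trans (s≤s s≤i)) i<L))

canonicalWordOf-staircase : ∀ xs ys → AllPairs _<_ ys →
  Staircase (length xs) 1 (canonicalWordOf (xs ++ ys))
canonicalWordOf-staircase xs ys sorted =
  subst (Staircase (length xs) 1) (sym (concatMap-cong (rowWord≡descendingRun w) (range1 (length w))))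
    (staircase-rows (λ i → length (rowBoxes w i))
      (λ n<i → cong length (rowBoxes-++-beyond {xs = xs} sorted n<i))
      (range1-sorted (length w)) (All.map proj₁ (range1-bounds (length w))))
  where
  w : List ℕ
  w = xs ++ ys

isAscentAt : List ℕ → ℕ → Bool
isAscentAt u k = letter u k <ᵇ letter u (suc k)

ascents-bounds : ∀ u → All (λ k → 1 ≤ k × k ≤ length u ∸ 1) (ascents u)
ascents-bounds u = All.filter⁺ (T? ∘ isAscentAt u) (range1-bounds (length u ∸ 1))

ascents-sorted : ∀ u → AllPairs _<_ (ascents u)
ascents-sorted u = AllPairs.filter⁺ (T? ∘ isAscentAt u) (range1-sorted (length u ∸ 1))

-- Two shifts are peeled off because letter u 0 = letter u 1 (truncated k ∸ 1),
-- so isAscentAt (y ∷ r) and isAscentAt (x ∷ y ∷ r) ∘ suc disagree at 0.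
ascents-shift : ∀ x y r →
  filterᵇ (isAscentAt (x ∷ y ∷ r)) (map suc (range1 (length r))) ≡ map suc (ascents (y ∷ r))
ascents-shift x y r = begin
  filterᵇ (isAscentAt (x ∷ y ∷ r)) (map suc (map suc (upTo (length r))))
    ≡⟨ filterᵇ-map (isAscentAt (x ∷ y ∷ r)) suc (map suc (upTo (length r))) ⟩
  map suc (filterᵇ (isAscentAt (x ∷ y ∷ r) ∘ suc) (map suc (upTo (length r))))
    ≡⟨ cong (map suc) (filterᵇ-map (isAscentAt (x ∷ y ∷ r) ∘ suc) suc (upTo (length r))) ⟩
  map suc (map suc (filterᵇ (isAscentAt (y ∷ r) ∘ suc) (upTo (length r))))
    ≡⟨ cong (map suc) (sym (filterᵇ-map (isAscentAt (y ∷ r)) suc (upTo (length r)))) ⟩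
  map suc (ascents (y ∷ r)) ∎
  where open ≡-Reasoning

ascents-ascent : x < y → ascents (x ∷ y ∷ r) ≡ 1 ∷ map suc (ascents (y ∷ r))
ascents-ascent {x} {y} {r} x<y = begin
  ascents (x ∷ y ∷ r)
    ≡⟨ cong (filterᵇ (isAscentAt (x ∷ y ∷ r))) (range1-suc (length r)) ⟩
  filterᵇ (isAscentAt (x ∷ y ∷ r)) (1 ∷ map suc (range1 (length r)))
    ≡⟨ filter-accept (T? ∘ isAscentAt (x ∷ y ∷ r)) {x = 1} {xs = map suc (range1 (length r))}
         (<⇒<ᵇ x<y) ⟩
  1 ∷ filterᵇ (isAscentAt (x ∷ y ∷ r)) (map suc (range1 (length r)))
    ≡⟨ cong (1 ∷_) (ascents-shift x y r) ⟩
  1 ∷ map suc (ascents (y ∷ r)) ∎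
  where open ≡-Reasoning

ascents-descent : y ≤ x → ascents (x ∷ y ∷ r) ≡ map suc (ascents (y ∷ r))
ascents-descent {y} {x} {r} y≤x = begin
  ascents (x ∷ y ∷ r)
    ≡⟨ cong (filterᵇ (isAscentAt (x ∷ y ∷ r))) (range1-suc (length r)) ⟩
  filterᵇ (isAscentAt (x ∷ y ∷ r)) (1 ∷ map suc (range1 (length r)))
    ≡⟨ filter-reject (T? ∘ isAscentAt (x ∷ y ∷ r)) {x = 1} {xs = map suc (range1 (length r))}
         (≤⇒≯ y≤x ∘ <ᵇ⇒< x y) ⟩
  filterᵇ (isAscentAt (x ∷ y ∷ r)) (map suc (range1 (length r)))
    ≡⟨ ascents-shift x y r ⟩
  map suc (ascents (y ∷ r)) ∎
  where open ≡-Reasoning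

staircase-∷-length-ascents : Staircase t s (x ∷ r) → s + length (ascents (x ∷ r)) ≤ t
staircase-∷-length-ascents {s = s} (final _ s≤t) = subst (_≤ _) (sym (+-identityʳ s)) s≤t
staircase-∷-length-ascents {t = t} {s = s} (ascent {y = y} {r} _ x<y st) = begin
  s + length (ascents (_ ∷ y ∷ r))
    ≡⟨ cong (λ A → s + length A) (ascents-ascent x<y) ⟩
  s + suc (length (map suc (ascents (y ∷ r))))
    ≡⟨ cong (λ n → s + suc n) (length-map suc (ascents (y ∷ r))) ⟩
  s + suc (length (ascents (y ∷ r)))
    ≡⟨ +-suc s _ ⟩
  suc s + length (ascents (y ∷ r))
    ≤⟨ staircase-∷-length-ascents st ⟩
  t ∎
  where open ≤-Reasoning
staircase-∷-length-ascents {t = t} {s = s} (descent {y = y} {r} _ y≤x st) = begin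
  s + length (ascents (_ ∷ y ∷ r))
    ≡⟨ cong (λ A → s + length A) (ascents-descent y≤x) ⟩
  s + length (map suc (ascents (y ∷ r)))
    ≡⟨ cong (s +_) (length-map suc (ascents (y ∷ r))) ⟩
  s + length (ascents (y ∷ r))
    ≤⟨ staircase-∷-length-ascents st ⟩
  t ∎
  where open ≤-Reasoning

staircase-length-ascents : Staircase t (suc s) v → length (ascents v) ≤ t
staircase-length-ascents {v = []}    _  = z≤n
staircase-length-ascents {s = s} {v = _ ∷ _} st =
  ≤-trans (m≤n+m _ (suc s)) (staircase-∷-length-ascents st)

staircase-floor≤head : Staircase t s (x ∷ r) → s ≤ x
staircase-floor≤head (final s≤x _)     = s≤x
staircase-floor≤head (ascent s≤x _ _)  = s≤x
staircase-floor≤head (descent s≤x _ _) = s≤x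

staircase-letter : Staircase t s v → 1 ≤ k → k ≤ length v → s + countBelow k (ascents v) ≤ letter v k
staircase-letter {s = s} {v = x ∷ r} {k = 1} st _ _ = begin
  s + countBelow 1 (ascents (x ∷ r))
    ≡⟨ cong (s +_) (countBelow-1 (All.map proj₁ (ascents-bounds (x ∷ r)))) ⟩
  s + 0
    ≡⟨ +-identityʳ s ⟩
  s
    ≤⟨ staircase-floor≤head st ⟩
  x ∎
  where open ≤-Reasoning
staircase-letter {s = s} {k = suc (suc k)} (ascent {y = y} {r} _ x<y st) _ (s≤s k<n) = begin
  s + countBelow (suc (suc k)) (ascents (_ ∷ y ∷ r))
    ≡⟨ cong (λ A → s + countBelow (suc (suc k)) A) (ascents-ascent x<y) ⟩
  s + suc (countBelow (suc (suc k)) (map suc (ascents (y ∷ r))))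
    ≡⟨ cong (λ c → s + suc c) (countBelow-map-suc (suc k) (ascents (y ∷ r))) ⟩
  s + suc (countBelow (suc k) (ascents (y ∷ r)))
    ≡⟨ +-suc s _ ⟩
  suc s + countBelow (suc k) (ascents (y ∷ r))
    ≤⟨ staircase-letter st (s≤s z≤n) k<n ⟩
  letter (y ∷ r) (suc k) ∎
  where open ≤-Reasoning
staircase-letter {s = s} {k = suc (suc k)} (descent {y = y} {r} _ y≤x st) _ (s≤s k<n) = begin
  s + countBelow (suc (suc k)) (ascents (_ ∷ y ∷ r))
    ≡⟨ cong (λ A → s + countBelow (suc (suc k)) A) (ascents-descent y≤x) ⟩
  s + countBelow (suc (suc k)) (map suc (ascents (y ∷ r)))
    ≡⟨ cong (s +_) (countBelow-map-suc (suc k) (ascents (y ∷ r))) ⟩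
  s + countBelow (suc k) (ascents (y ∷ r))
    ≤⟨ staircase-letter st (s≤s z≤n) k<n ⟩
  letter (y ∷ r) (suc k) ∎
  where open ≤-Reasoning
staircase-letter {k = suc (suc k)} (final _ _) _ (s≤s ())

staircase-segments : Staircase t (suc s) v →
  ∀ j → 1 ≤ j → j ≤ length (ascents v) →
  ∀ k → nth (0 ∷ ascents v) (j ∸ 1) < k → k ≤ nth (0 ∷ ascents v) j → s + j ≤ letter v k
staircase-segments {s = s} {v = v} st (suc i) _ j≤p k after upTo-kⱼ = begin
  s + suc i
    ≡⟨ +-suc s i ⟩
  suc s + i
    ≤⟨ +-monoʳ-≤ (suc s) (countBelow-nth-0∷ (ascents-sorted v) (<⇒≤ j≤p) after) ⟩
  suc s + countBelow k (ascents v)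
    ≤⟨ staircase-letter st (≤-trans (s≤s z≤n) after) k≤n ⟩
  letter v k ∎
  where
  open ≤-Reasoning
  k≤n : k ≤ length v
  k≤n = ≤-trans upTo-kⱼ (≤-trans (proj₂ (nth-All (ascents-bounds v) j≤p)) (m∸n≤m (length v) 1))

lemma2 : ∀ (a b : ℕ) (ρ : Matrix a b) → IsPartialPerm ρ →
    length (ascents (canonicalWord ρ)) ≤ a ×
    (∀ (j : ℕ) → 1 ≤ j → j ≤ length (ascents (canonicalWord ρ)) →
      ∀ (k : ℕ) →
        nth (0 ∷ ascents (canonicalWord ρ)) (j ∸ 1) < k →
        k ≤ nth (0 ∷ ascents (canonicalWord ρ)) j →
        j ≤ letter (canonicalWord ρ) k)
lemma2 a b ρ _ = staircase-length-ascents staircase , staircase-segments staircase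
  where
  topRows : List ℕ
  topRows = map (embTop ρ) (range1 a)
  length-topRows : length topRows ≡ a
  length-topRows =
    trans (length-map (embTop ρ) (range1 a)) (trans (length-map suc (upTo a)) (length-upTo a))
  lackCols-sorted : AllPairs _<_ (lackCols ρ)
  lackCols-sorted = AllPairs.filter⁺ _ (range1-sorted (a + b))
  staircase : Staircase a 1 (canonicalWord ρ)
  staircase = subst (λ t → Staircase t 1 (canonicalWord ρ)) length-topRows
    (canonicalWordOf-staircase topRows (lackCols ρ) lackCols-sorted)
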